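{- Let $D=xy\frac{\partial}{\partial x}+x^2\frac{\partial}{\partial y}$ be the derivation on Laurent polynomials in $x,y$ with $D(x)=xy$, $D(y)=x^2$, and for a Laurent polynomial $f$ let $\mathrm{Gen}(f,t)=\sum_{n\ge0}D^n(f)\frac{t^n}{n!}$. Then $$\mathrm{Gen}(x,t)=\frac{x\sqrt{y^2-x^2}}{\sqrt{y^2-x^2}\cosh\big(t\sqrt{y^2-x^2}\big)-y\sinh\big(t\sqrt{y^2-x^2}\big)}.$$
   Context: Identities are of formal power series in $t$; with $s=\sqrt{y^2-x^2}$, the factor $s$ cancels between numerator and denominator and $\cosh(ts)$, $\sinh(ts)/s$ are the power series $\sum_n s^{2n}t^{2n}/(2n)!$ and $\sum_n s^{2n}t^{2n+1}/(2n+1)!$, involving only powers of $y^2-x^2$. -}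

module Defs where

open import Data.Nat as ℕ using (ℕ; zero; suc; _!)
open import Data.Nat.Properties using (_!≢0)
open import Data.Integer as ℤ using (ℤ; +_)
open import Data.Rational as ℚ using (ℚ)
open import Data.List using (List; []; _∷_; _++_; map; concatMap; foldr)
open import Data.Product using (_×_; _,_)
open import Relation.Nullary.Decidable using (does)
open import Data.Bool using (Bool; true; false; not; if_then_else_; _∧_)
open import Relation.Binary.PropositionalEquality using (_≡_)

-- Laurent polynomials in x, y with rational coefficients, represented
-- as finite lists of monomials  c · x^i · y^j  (c : ℚ, i j : ℤ).

Mono : Set
Mono = ℚ × ℤ × ℤ

LPoly : Set
LPoly = List Mono

coeff : LPoly → ℤ → ℤ → ℚ
coeff []                 i j = ℚ.0ℚ
coeff ((c , a , b) ∷ ms) i j =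
  (if does (a ℤ.≟ i) ∧ does (b ℤ.≟ j) then c else ℚ.0ℚ) ℚ.+ coeff ms i j

_≈L_ : LPoly → LPoly → Set
p ≈L q = ∀ i j → coeff p i j ≡ coeff q i j

infix 4 _≈L_

0L : LPoly
0L = []

1L : LPoly
1L = (ℚ.1ℚ , + 0 , + 0) ∷ []

xL : LPoly
xL = (ℚ.1ℚ , + 1 , + 0) ∷ []

yL : LPoly
yL = (ℚ.1ℚ , + 0 , + 1) ∷ []

_+L_ : LPoly → LPoly → LPoly
_+L_ = _++_

-L_ : LPoly → LPoly
-L_ = map (λ { (c , a , b) → (ℚ.- c , a , b) })

_-L_ : LPoly → LPoly → LPoly
p -L q = p +L (-L q)

_*L_ : LPoly → LPoly → LPoly
p *L q = concatMap (λ { (c , a , b) →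
           map (λ { (d , a' , b') → (c ℚ.* d , a ℤ.+ a' , b ℤ.+ b') }) q }) p

_·L_ : ℚ → LPoly → LPoly
r ·L p = map (λ { (c , a , b) → (r ℚ.* c , a , b) }) p

_^L_ : LPoly → ℕ → LPoly
p ^L zero  = 1L
p ^L suc n = p *L (p ^L n)

infixl 6 _+L_ _-L_
infixl 7 _*L_ _·L_
infixr 8 _^L_

-- The derivation D = x y ∂/∂x + x² ∂/∂y  (D x = x y, D y = x²),
-- extended ℚ-linearly:  D(c x^a y^b) = c·a x^a y^(b+1) + c·b x^(a+2) y^(b-1).

Dmono : Mono → LPoly
Dmono (c , a , b) =
  (c ℚ.* (a ℚ./ 1) , a , b ℤ.+ + 1) ∷
  (c ℚ.* (b ℚ./ 1) , a ℤ.+ + 2 , b ℤ.- + 1) ∷ []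

D : LPoly → LPoly
D = concatMap Dmono

D^ : ℕ → LPoly → LPoly
D^ zero    f = f
D^ (suc n) f = D (D^ n f)

PS : Set
PS = ℕ → LPoly

invFact : ℕ → ℚ
invFact n = (+ 1) ℚ./ (n !)
  where instance _ = n !≢0

Gen : LPoly → PS
Gen f n = invFact n ·L D^ n f

s² : LPoly
s² = yL *L yL -L xL *L xL

even : ℕ → Bool
even zero    = true
even (suc n) = not (even n)

-- cosh(t s) = Σ_k s^{2k} t^{2k} / (2k)!
-- (coefficient of tⁿ: s^n/n! for n even, 0 for n odd; s^n = (s²)^(n/2))
coshS : PS
coshS n = if even n then invFact n ·L (s² ^L (n ℕ./ 2)) else 0L

-- sinh(t s)/s = Σ_k s^{2k} t^{2k+1} / (2k+1)!
-- (coefficient of tⁿ: s^(n-1)/n! for n odd, 0 for n even; s^(n-1) = (s²)^(n/2))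
sinhS/s : PS
sinhS/s n = if even n then 0L else invFact n ·L (s² ^L (n ℕ./ 2))

constPS : LPoly → PS
constPS p zero    = p
constPS p (suc n) = 0L

_*PS_ : PS → LPoly → PS
(A *PS p) n = A n *L p

_-PS_ : PS → PS → PS
(A -PS B) n = A n -L B n

_≈PS_ : PS → PS → Set
A ≈PS B = ∀ n → A n ≈L B n

sumL : ℕ → (ℕ → LPoly) → LPoly
sumL zero    f = f zero
sumL (suc n) f = sumL n f +L f (suc n)

-- Division N / B of power series, for B with constant term 1 (so B is a
-- unit in the power series ring).  The quotient Q is the unique series
-- with B·Q = N, computed by  Q₀ = N₀,  Qₙ = Nₙ − Σ_{k<n} B_{n−k} Q_k.
-- quotList N B n = [Q_n , Q_{n-1} , … , Q_0]
-- correction term  Σ_{k<n} B_{n−k} Q_k  given qs = [Q_{n-1},…,Q_0]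
-- (element at position j of qs is Q_{n-1-j}, paired with B_{j+1})
corr : PS → List LPoly → ℕ → LPoly
corr B []       j = 0L
corr B (q ∷ qs) j = B (suc j) *L q +L corr B qs (suc j)

quotList : PS → PS → ℕ → List LPoly
quotList N B zero    = N zero ∷ []
quotList N B (suc n) = let qs = quotList N B n in (N (suc n) -L corr B qs 0) ∷ qs

headL : List LPoly → LPoly
headL []      = 0L
headL (q ∷ _) = q

_÷PS_ : PS → PS → PS
(N ÷PS B) n = headL (quotList N B n)

{-# OPTIONS --safe #-}

-- Gen(f) = Σ Dⁿ(f) tⁿ/n! is exp(tD) applied to f, so the Leibniz rule makes Gen multiplicative:
-- Gen(fg) is the Cauchy product of Gen(f) and Gen(g).  Since D(1/x) = −y/x, D(y/x) = −s²/x and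
-- D(s²) = 0 for s² = y² − x², the derivatives of 1/x alternate between s²ᵏ/x and −s²ᵏy/x, that is
-- Gen(1/x) = (cosh(ts) − y sinh(ts)/s)/x.  Hence (cosh(ts) − y sinh(ts)/s)·Gen(x) =
-- x·Gen(1/x)·Gen(x) = x·Gen(1) = x, and because the first factor has constant term 1 this pins
-- Gen(x) down as the quotient.

module Submission where

open import Defs

open import Data.Nat as ℕ using (ℕ; zero; suc; _!)
import Data.Nat.Properties as ℕP
import Data.Nat.DivMod as ℕDivMod
import Data.Nat.Divisibility as ℕDiv
import Data.Nat.Tactic.RingSolver as ℕSolver
open import Data.Integer as ℤ using (ℤ; +_)
import Data.Integer.Properties as ℤP
import Data.Integer.Tactic.RingSolver as ℤSolver
open import Data.Rational as ℚ using (ℚ; 0ℚ; 1ℚ)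
import Data.Rational.Properties as ℚP
import Data.Rational.Solver
module ℚSolver = Data.Rational.Solver.+-*-Solver
import Data.Rational.Unnormalised as ℚᵘ
import Data.Rational.Unnormalised.Properties as ℚᵘP
open import Relation.Binary.PropositionalEquality
  using (_≡_; refl; sym; trans; cong; cong₂; module ≡-Reasoning)
open import Data.List using ([]; _∷_; _++_; map)
import Data.List.Properties as ListP
open import Data.Product using (_,_; ∃-syntax)
open import Data.Sum using (_⊎_; inj₁; inj₂)
open import Data.Bool using (Bool; true; false; if_then_else_; _∧_)
open import Relation.Nullary.Decidable using (Dec; yes; no; does; does-⇔)
import Data.Bool.Properties as BoolP
open import Function using (mk⇔; _∘_)
open import Level using (0ℓ; _⊔_)
open import Algebra.Bundles using (CommutativeRing; CommutativeMonoid)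
open import Algebra.Solver.Ring.AlmostCommutativeRing
  using (AlmostCommutativeRing; fromCommutativeRing; -raw-almostCommutative⟶)
import Algebra.Solver.Ring
import Algebra.Properties.Semiring.Mult
import Algebra.Properties.CommutativeMonoid.Mult
import Algebra.Properties.CommutativeSemigroup
import Algebra.Properties.Group
import Algebra.Properties.Ring
import Algebra.Properties.AbelianGroup
import Relation.Binary.Reasoning.Setoid
open import Data.Maybe using (nothing)

-- Power series over a commutative ring

-- With no equality test on coefficients this solver cannot cancel terms (it cannot show x − x ≈ 0).
module CommutativeRingSolver {c ℓ} (R : CommutativeRing c ℓ) where
  private
    R′ : AlmostCommutativeRing c ℓ
    R′ = fromCommutativeRing R
  open Algebra.Solver.Ring (AlmostCommutativeRing.rawRing R′) R′ (-raw-almostCommutative⟶ R′)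
    (λ _ _ → nothing) public

module CauchyProduct {c ℓ} (R : CommutativeRing c ℓ) where
  open CommutativeRing R renaming (refl to ≈-refl; sym to ≈-sym; trans to ≈-trans)
  open CommutativeRingSolver R using (solve; _:+_; _:*_; _:=_)
  open Algebra.Properties.Semiring.Mult semiring using (_×_; ×-homo-1; ×-comm-*)
  open Algebra.Properties.CommutativeMonoid.Mult +-commutativeMonoid using (×-distrib-+)
  open Algebra.Properties.CommutativeSemigroup +-commutativeSemigroup using (interchange)
  open Relation.Binary.Reasoning.Setoid (CommutativeRing.setoid R)

  Series : Set c
  Series = ℕ → Carrier

  cauchy : Series → Series → Series
  cauchy A B zero    = A 0 * B 0
  cauchy A B (suc n) = A 0 * B (suc n) + cauchy (A ∘ suc) B n

  ∂ : Series → Series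
  ∂ A k = suc k × A (suc k)

  record IsDerivation (d : Carrier → Carrier) : Set (c ⊔ ℓ) where
    field
      d-+     : ∀ x y → d (x + y) ≈ d x + d y
      leibniz : ∀ x y → d (x * y) ≈ d x * y + x * d y

  cauchy-cong : ∀ n {A A′ B B′} → (∀ k → A k ≈ A′ k) → (∀ k → B k ≈ B′ k) →
                cauchy A B n ≈ cauchy A′ B′ n
  cauchy-cong zero    A≈ B≈ = *-cong (A≈ 0) (B≈ 0)
  cauchy-cong (suc n) A≈ B≈ = +-cong (*-cong (A≈ 0) (B≈ (suc n))) (cauchy-cong n (A≈ ∘ suc) B≈)

  cauchy-congʳ-≤ : ∀ n A {B B′} → (∀ k → k ℕ.≤ n → B k ≈ B′ k) → cauchy A B n ≈ cauchy A B′ n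
  cauchy-congʳ-≤ zero    A B≈ = *-congˡ (B≈ 0 ℕ.z≤n)
  cauchy-congʳ-≤ (suc n) A B≈ =
    +-cong (*-congˡ (B≈ (suc n) ℕP.≤-refl)) (cauchy-congʳ-≤ n (A ∘ suc) (λ k k≤n → B≈ k (ℕP.m≤n⇒m≤1+n k≤n)))

  cauchy-+ˡ : ∀ n A A′ B → cauchy (λ k → A k + A′ k) B n ≈ cauchy A B n + cauchy A′ B n
  cauchy-+ˡ zero    A A′ B = distribʳ (B 0) (A 0) (A′ 0)
  cauchy-+ˡ (suc n) A A′ B = begin
    (A 0 + A′ 0) * B (suc n) + cauchy (λ k → A (suc k) + A′ (suc k)) B n
      ≈⟨ +-cong (distribʳ (B (suc n)) (A 0) (A′ 0)) (cauchy-+ˡ n (A ∘ suc) (A′ ∘ suc) B) ⟩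
    (A 0 * B (suc n) + A′ 0 * B (suc n)) + (cauchy (A ∘ suc) B n + cauchy (A′ ∘ suc) B n)
      ≈⟨ interchange (A 0 * B (suc n)) (A′ 0 * B (suc n)) (cauchy (A ∘ suc) B n) (cauchy (A′ ∘ suc) B n) ⟩
    cauchy A B (suc n) + cauchy A′ B (suc n) ∎

  cauchy-*ˡ : ∀ n a A B → cauchy (λ k → a * A k) B n ≈ a * cauchy A B n
  cauchy-*ˡ zero    a A B = *-assoc a (A 0) (B 0)
  cauchy-*ˡ (suc n) a A B =
    ≈-trans (+-cong (*-assoc a (A 0) (B (suc n))) (cauchy-*ˡ n a (A ∘ suc) B))
          (≈-sym (distribˡ a (A 0 * B (suc n)) (cauchy (A ∘ suc) B n)))

  cauchy-derivation : ∀ {d} → IsDerivation d → ∀ n A B →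
                      d (cauchy A B n) ≈ cauchy (d ∘ A) B n + cauchy A (d ∘ B) n
  cauchy-derivation isD zero    A B = IsDerivation.leibniz isD (A 0) (B 0)
  cauchy-derivation {d} isD (suc n) A B = begin
    d (A 0 * B (suc n) + cauchy (A ∘ suc) B n)
      ≈⟨ d-+ (A 0 * B (suc n)) (cauchy (A ∘ suc) B n) ⟩
    d (A 0 * B (suc n)) + d (cauchy (A ∘ suc) B n)
      ≈⟨ +-cong (leibniz (A 0) (B (suc n))) (cauchy-derivation isD n (A ∘ suc) B) ⟩
    (d (A 0) * B (suc n) + A 0 * d (B (suc n))) + (cauchy (d ∘ A ∘ suc) B n + cauchy (A ∘ suc) (d ∘ B) n)
      ≈⟨ interchange _ _ _ _ ⟩
    cauchy (d ∘ A) B (suc n) + cauchy A (d ∘ B) (suc n) ∎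
    where open IsDerivation isD

  -- The coefficient of tⁿ in the product rule (AB)′ = A′B + AB′.
  cauchy-∂ : ∀ n A B → cauchy (∂ A) B n + cauchy A (∂ B) n ≈ suc n × cauchy A B (suc n)
  cauchy-∂ zero A B = begin
    (1 × A 1) * B 0 + A 0 * (1 × B 1)
      ≈⟨ +-cong (*-congʳ (×-homo-1 (A 1))) (*-congˡ (×-homo-1 (B 1))) ⟩
    A 1 * B 0 + A 0 * B 1
      ≈⟨ +-comm (A 1 * B 0) (A 0 * B 1) ⟩
    cauchy A B 1
      ≈⟨ ×-homo-1 (cauchy A B 1) ⟨
    1 × cauchy A B 1 ∎
  -- (k + 2) × Aₖ₊₂ unfolds to Aₖ₊₂ + (k + 1) × Aₖ₊₂, which splits ∂ A ∘ suc in the first step.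
  cauchy-∂ (suc m) A B = begin
    ((1 × A 1) * B₁ + cauchy (∂ A ∘ suc) B m) + (A 0 * ∂ B (suc m) + I₂)
      ≈⟨ +-congʳ (+-cong (*-congʳ (×-homo-1 (A 1))) (cauchy-+ˡ m (A ∘ suc ∘ suc) (∂ (A ∘ suc)) B)) ⟩
    (A 1 * B₁ + (C + I₁)) + (A 0 * (B₂ + S) + I₂)
      ≈⟨ solve 8 (λ a₀ a₁ b₁ b₂ s c i₁ i₂ →
                    (a₁ :* b₁ :+ (c :+ i₁)) :+ (a₀ :* (b₂ :+ s) :+ i₂)
                 := (a₀ :* b₂ :+ (a₁ :* b₁ :+ c)) :+ (a₀ :* s :+ (i₁ :+ i₂)))
               ≈-refl (A 0) (A 1) B₁ B₂ S C I₁ I₂ ⟩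
    X + (A 0 * S + (I₁ + I₂))
      ≈⟨ +-congˡ (+-congˡ (cauchy-∂ m (A ∘ suc) B)) ⟩
    X + (A 0 * S + suc m × cauchy (A ∘ suc) B (suc m))
      ≈⟨ +-congˡ (+-congʳ (×-comm-* (suc m) (A 0) B₂)) ⟩
    X + (suc m × (A 0 * B₂) + suc m × cauchy (A ∘ suc) B (suc m))
      ≈⟨ +-congˡ (×-distrib-+ (A 0 * B₂) (cauchy (A ∘ suc) B (suc m)) (suc m)) ⟨
    X + suc m × X ∎
    where
    B₁ = B (suc m)
    B₂ = B (suc (suc m))
    S  = suc m × B₂
    C  = cauchy (A ∘ suc ∘ suc) B m
    I₁ = cauchy (∂ (A ∘ suc)) B m
    I₂ = cauchy (A ∘ suc) (∂ B) m
    X  = cauchy A B (suc (suc m))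

_/1 : ℤ → ℚ
a /1 = a ℚ./ 1

fromℚᵘ-homo-+ : ∀ p q → ℚ.fromℚᵘ (p ℚᵘ.+ q) ≡ ℚ.fromℚᵘ p ℚ.+ ℚ.fromℚᵘ q
fromℚᵘ-homo-+ p q = ℚP.toℚᵘ-injective (ℚᵘP.≃-trans (ℚP.toℚᵘ-fromℚᵘ (p ℚᵘ.+ q))
  (ℚᵘP.≃-sym (ℚᵘP.≃-trans (ℚP.toℚᵘ-homo-+ (ℚ.fromℚᵘ p) (ℚ.fromℚᵘ q))
    (ℚᵘP.+-cong (ℚP.toℚᵘ-fromℚᵘ p) (ℚP.toℚᵘ-fromℚᵘ q)))))

fromℚᵘ-homo-* : ∀ p q → ℚ.fromℚᵘ (p ℚᵘ.* q) ≡ ℚ.fromℚᵘ p ℚ.* ℚ.fromℚᵘ q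
fromℚᵘ-homo-* p q = ℚP.toℚᵘ-injective (ℚᵘP.≃-trans (ℚP.toℚᵘ-fromℚᵘ (p ℚᵘ.* q))
  (ℚᵘP.≃-sym (ℚᵘP.≃-trans (ℚP.toℚᵘ-homo-* (ℚ.fromℚᵘ p) (ℚ.fromℚᵘ q))
    (ℚᵘP.*-cong (ℚP.toℚᵘ-fromℚᵘ p) (ℚP.toℚᵘ-fromℚᵘ q)))))

/1-homo-+ : ∀ a b → (a ℤ.+ b) /1 ≡ a /1 ℚ.+ b /1
/1-homo-+ a b =
  trans (ℚP.fromℚᵘ-cong {ℚᵘ.mkℚᵘ (a ℤ.+ b) 0} {ℚᵘ.mkℚᵘ a 0 ℚᵘ.+ ℚᵘ.mkℚᵘ b 0} (ℚᵘ.*≡* (cross a b)))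
        (fromℚᵘ-homo-+ (ℚᵘ.mkℚᵘ a 0) (ℚᵘ.mkℚᵘ b 0))
  where
  cross : ∀ a b → (a ℤ.+ b) ℤ.* + 1 ≡ (a ℤ.* + 1 ℤ.+ b ℤ.* + 1) ℤ.* + 1
  cross = ℤSolver.solve-∀

1/-cancelˡ-* : ∀ n m .{{_ : ℕ.NonZero m}} →
               (+ 1) ℚ./ m ≡ (+ suc n) /1 ℚ.* ((+ 1) ℚ./ (suc n ℕ.* m)) {{ℕP.m*n≢0 (suc n) m}}
1/-cancelˡ-* n (suc k) =
  trans (ℚP.fromℚᵘ-cong {ℚᵘ.mkℚᵘ (+ 1) k} {ℚᵘ.mkℚᵘ (+ suc n) 0 ℚᵘ.* ℚᵘ.mkℚᵘ (+ 1) k′}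
                        (ℚᵘ.*≡* (cong +_ (ℕSolver.solve (n ∷ k ∷ [])))))
        (fromℚᵘ-homo-* (ℚᵘ.mkℚᵘ (+ suc n) 0) (ℚᵘ.mkℚᵘ (+ 1) k′))
  where k′ = k ℕ.+ n ℕ.* suc k

1/suc*suc≡1 : ∀ n → ((+ 1) ℚ./ suc n) ℚ.* (+ suc n) /1 ≡ 1ℚ
1/suc*suc≡1 n =
  trans (sym (fromℚᵘ-homo-* (ℚᵘ.mkℚᵘ (+ 1) n) (ℚᵘ.mkℚᵘ (+ suc n) 0)))
        (ℚP.fromℚᵘ-cong {ℚᵘ.mkℚᵘ (+ 1) n ℚᵘ.* ℚᵘ.mkℚᵘ (+ suc n) 0} {ℚᵘ.mkℚᵘ (+ 1) 0}
                        (ℚᵘ.*≡* (cong +_ (ℕSolver.solve (n ∷ [])))))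

invFact-suc : ∀ n → invFact n ≡ (+ suc n) /1 ℚ.* invFact (suc n)
invFact-suc n = 1/-cancelˡ-* n (n !) {{ℕP._!≢0 n}}

module ℚ+ = Algebra.Properties.CommutativeSemigroup
  (CommutativeMonoid.commutativeSemigroup ℚP.+-0-commutativeMonoid)
module ℚ* = Algebra.Properties.CommutativeSemigroup
  (CommutativeMonoid.commutativeSemigroup ℚP.*-1-commutativeMonoid)

if-push : (f : ℚ → ℚ) → f 0ℚ ≡ 0ℚ → ∀ t c → (if t then f c else 0ℚ) ≡ f (if t then c else 0ℚ)
if-push f f0≡0 true  c = refl
if-push f f0≡0 false c = sym f0≡0

does-≟-translate : ∀ a b k → does (a ℤ.+ k ℤ.≟ b) ≡ does (a ℤ.≟ b ℤ.- k)
does-≟-translate a b k = does-⇔ (mk⇔ to from) (a ℤ.+ k ℤ.≟ b) (a ℤ.≟ b ℤ.- k)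
  where
  to : a ℤ.+ k ≡ b → a ≡ b ℤ.- k
  to refl = ℤSolver.solve (a ∷ k ∷ [])
  from : a ≡ b ℤ.- k → a ℤ.+ k ≡ b
  from refl = ℤSolver.solve (b ∷ k ∷ [])

mono : Mono → LPoly
mono m = m ∷ []

matches : ℤ → ℤ → ℤ → ℤ → Bool
matches a b i j = does (a ℤ.≟ i) ∧ does (b ℤ.≟ j)

coeff-++ : ∀ p q i j → coeff (p ++ q) i j ≡ coeff p i j ℚ.+ coeff q i j
coeff-++ []                q i j = sym (ℚP.+-identityˡ (coeff q i j))
coeff-++ ((c , a , b) ∷ p) q i j = begin
  t ℚ.+ coeff (p ++ q) i j             ≡⟨ cong (t ℚ.+_) (coeff-++ p q i j) ⟩
  t ℚ.+ (coeff p i j ℚ.+ coeff q i j)  ≡⟨ ℚP.+-assoc t (coeff p i j) (coeff q i j) ⟨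
  t ℚ.+ coeff p i j ℚ.+ coeff q i j    ∎
  where
  open ≡-Reasoning
  t = if matches a b i j then c else 0ℚ

coeff-neg : ∀ p i j → coeff (-L p) i j ≡ ℚ.- coeff p i j
coeff-neg []                i j = refl
coeff-neg ((c , a , b) ∷ p) i j =
  trans (cong₂ ℚ._+_ (if-push ℚ.-_ refl (matches a b i j) c) (coeff-neg p i j))
        (sym (ℚP.neg-distrib-+ (if matches a b i j then c else 0ℚ) (coeff p i j)))

coeff-·L : ∀ r p i j → coeff (r ·L p) i j ≡ r ℚ.* coeff p i j
coeff-·L r []                i j = sym (ℚP.*-zeroʳ r)
coeff-·L r ((c , a , b) ∷ p) i j =
  trans (cong₂ ℚ._+_ (if-push (r ℚ.*_) (ℚP.*-zeroʳ r) (matches a b i j) c) (coeff-·L r p i j))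
        (sym (ℚP.*-distribˡ-+ r (if matches a b i j then c else 0ℚ) (coeff p i j)))

shiftBy : ℚ → ℤ → ℤ → Mono → Mono
shiftBy c a b (d , a′ , b′) = (c ℚ.* d , a ℤ.+ a′ , b ℤ.+ b′)

does-≟-shift : ∀ a a′ i → does (a ℤ.+ a′ ℤ.≟ i) ≡ does (a′ ℤ.≟ i ℤ.- a)
does-≟-shift a a′ i =
  trans (cong (λ z → does (z ℤ.≟ i)) (ℤP.+-comm a a′)) (does-≟-translate a′ i a)

coeff-map-shiftBy : ∀ c a b q i j →
  coeff (map (shiftBy c a b) q) i j ≡ c ℚ.* coeff q (i ℤ.- a) (j ℤ.- b)
coeff-map-shiftBy c a b []                  i j = sym (ℚP.*-zeroʳ c)
coeff-map-shiftBy c a b ((d , a′ , b′) ∷ q) i j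
  rewrite does-≟-shift a a′ i | does-≟-shift b b′ j =
  trans (cong₂ ℚ._+_ (if-push (c ℚ.*_) (ℚP.*-zeroʳ c) (matches a′ b′ (i ℤ.- a) (j ℤ.- b)) d)
                     (coeff-map-shiftBy c a b q i j))
        (sym (ℚP.*-distribˡ-+ c _ (coeff q (i ℤ.- a) (j ℤ.- b))))

-‿-‿comm : ∀ i a b → i ℤ.- a ℤ.- b ≡ i ℤ.- b ℤ.- a
-‿-‿comm = ℤSolver.solve-∀

-‿+ : ∀ i a b → i ℤ.- (a ℤ.+ b) ≡ i ℤ.- a ℤ.- b
-‿+ = ℤSolver.solve-∀

Coeffs : Set
Coeffs = ℤ → ℤ → ℚ

convolve : LPoly → Coeffs → Coeffs
convolve []                g i j = 0ℚ
convolve ((c , a , b) ∷ p) g i j = c ℚ.* g (i ℤ.- a) (j ℤ.- b) ℚ.+ convolve p g i j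

coeff-*L : ∀ p q i j → coeff (p *L q) i j ≡ convolve p (coeff q) i j
coeff-*L []                q i j = refl
coeff-*L ((c , a , b) ∷ p) q i j =
  trans (coeff-++ (map (shiftBy c a b) q) (p *L q) i j)
        (cong₂ ℚ._+_ (coeff-map-shiftBy c a b q i j) (coeff-*L p q i j))

convolve-cong : ∀ p {g h : Coeffs} → (∀ i j → g i j ≡ h i j) → ∀ i j → convolve p g i j ≡ convolve p h i j
convolve-cong []                g≡h i j = refl
convolve-cong ((c , a , b) ∷ p) g≡h i j =
  cong₂ ℚ._+_ (cong (c ℚ.*_) (g≡h (i ℤ.- a) (j ℤ.- b))) (convolve-cong p g≡h i j)

convolve-+ : ∀ p g h i j →
  convolve p (λ i j → g i j ℚ.+ h i j) i j ≡ convolve p g i j ℚ.+ convolve p h i j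
convolve-+ []                g h i j = refl
convolve-+ ((c , a , b) ∷ p) g h i j =
  trans (cong₂ ℚ._+_ (ℚP.*-distribˡ-+ c (g i′ j′) (h i′ j′)) (convolve-+ p g h i j))
        (ℚ+.interchange (c ℚ.* g i′ j′) (c ℚ.* h i′ j′) (convolve p g i j) (convolve p h i j))
  where
  i′ = i ℤ.- a
  j′ = j ℤ.- b

convolve-++ : ∀ p q g i j → convolve (p ++ q) g i j ≡ convolve p g i j ℚ.+ convolve q g i j
convolve-++ []                q g i j = sym (ℚP.+-identityˡ (convolve q g i j))
convolve-++ ((c , a , b) ∷ p) q g i j =
  trans (cong (t ℚ.+_) (convolve-++ p q g i j)) (sym (ℚP.+-assoc t (convolve p g i j) (convolve q g i j)))
  where t = c ℚ.* g (i ℤ.- a) (j ℤ.- b)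

convolve-shift : ∀ q c a b g i j →
  convolve q (λ i j → c ℚ.* g (i ℤ.- a) (j ℤ.- b)) i j ≡ c ℚ.* convolve q g (i ℤ.- a) (j ℤ.- b)
convolve-shift []                  c a b g i j = sym (ℚP.*-zeroʳ c)
convolve-shift ((d , a′ , b′) ∷ q) c a b g i j =
  trans (cong₂ ℚ._+_ (trans (cong₂ (λ u v → d ℚ.* (c ℚ.* g u v)) (-‿-‿comm i a′ a) (-‿-‿comm j b′ b))
                            (ℚ*.x∙yz≈y∙xz d c (g ((i ℤ.- a) ℤ.- a′) ((j ℤ.- b) ℤ.- b′))))
                     (convolve-shift q c a b g i j))
        (sym (ℚP.*-distribˡ-+ c _ (convolve q g (i ℤ.- a) (j ℤ.- b))))

convolve-map-shiftBy : ∀ c a b q g i j →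
  convolve (map (shiftBy c a b) q) g i j ≡ c ℚ.* convolve q g (i ℤ.- a) (j ℤ.- b)
convolve-map-shiftBy c a b []                  g i j = sym (ℚP.*-zeroʳ c)
convolve-map-shiftBy c a b ((d , a′ , b′) ∷ q) g i j =
  trans (cong₂ ℚ._+_ (trans (cong₂ (λ u v → (c ℚ.* d) ℚ.* g u v) (-‿+ i a a′) (-‿+ j b b′))
                            (ℚP.*-assoc c d (g ((i ℤ.- a) ℤ.- a′) ((j ℤ.- b) ℤ.- b′))))
                     (convolve-map-shiftBy c a b q g i j))
        (sym (ℚP.*-distribˡ-+ c _ (convolve q g (i ℤ.- a) (j ℤ.- b))))

convolve-*L : ∀ p q g i j → convolve (p *L q) g i j ≡ convolve p (convolve q g) i j
convolve-*L []                q g i j = refl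
convolve-*L ((c , a , b) ∷ p) q g i j =
  trans (convolve-++ (map (shiftBy c a b) q) (p *L q) g i j)
        (cong₂ ℚ._+_ (convolve-map-shiftBy c a b q g i j) (convolve-*L p q g i j))

convolve-zero : ∀ q i j → convolve q (λ _ _ → 0ℚ) i j ≡ 0ℚ
convolve-zero []                i j = refl
convolve-zero ((c , a , b) ∷ q) i j = cong₂ ℚ._+_ (ℚP.*-zeroʳ c) (convolve-zero q i j)

convolve-comm : ∀ p q g i j → convolve p (convolve q g) i j ≡ convolve q (convolve p g) i j
convolve-comm []                q g i j = sym (convolve-zero q i j)
convolve-comm ((c , a , b) ∷ p) q g i j =
  trans (cong₂ ℚ._+_ (sym (convolve-shift q c a b g i j)) (convolve-comm p q g i j))
        (sym (convolve-+ q (λ i j → c ℚ.* g (i ℤ.- a) (j ℤ.- b)) (convolve p g) i j))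

δ : Coeffs
δ = coeff 1L

does-≟-zero : ∀ a i → does (a ℤ.≟ i) ≡ does (+ 0 ℤ.≟ i ℤ.- a)
does-≟-zero a i =
  trans (cong (λ z → does (z ℤ.≟ i)) (sym (ℤP.+-identityˡ a))) (does-≟-translate (+ 0) i a)

coeff≡convolve-δ : ∀ p i j → coeff p i j ≡ convolve p δ i j
coeff≡convolve-δ []                i j = refl
coeff≡convolve-δ ((c , a , b) ∷ p) i j rewrite does-≟-zero a i | does-≟-zero b j =
  cong₂ ℚ._+_ (unit (matches (+ 0) (+ 0) (i ℤ.- a) (j ℤ.- b))) (coeff≡convolve-δ p i j)
  where
  unit : ∀ t → (if t then c else 0ℚ) ≡ c ℚ.* ((if t then 1ℚ else 0ℚ) ℚ.+ 0ℚ)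
  unit true  = sym (trans (cong (c ℚ.*_) (ℚP.+-identityʳ 1ℚ)) (ℚP.*-identityʳ c))
  unit false = sym (ℚP.*-zeroʳ c)

-- The ring of Laurent polynomials

-- A record rather than _≈L_ itself, so that p and q can be inferred from a proof of p ≈ q.
record _≈_ (p q : LPoly) : Set where
  constructor ≈-coeffs
  field coeffs-≡ : p ≈L q
open _≈_ public

infix 4 _≈_

≈-refl : ∀ {p} → p ≈ p
≈-refl = ≈-coeffs λ i j → refl

≈-sym : ∀ {p q} → p ≈ q → q ≈ p
≈-sym (≈-coeffs e) = ≈-coeffs λ i j → sym (e i j)

≈-trans : ∀ {p q r} → p ≈ q → q ≈ r → p ≈ r
≈-trans (≈-coeffs e) (≈-coeffs f) = ≈-coeffs λ i j → trans (e i j) (f i j)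

≡⇒≈ : ∀ {p q} → p ≡ q → p ≈ q
≡⇒≈ refl = ≈-refl

+-cong : ∀ {p p′ q q′} → p ≈ p′ → q ≈ q′ → p +L q ≈ p′ +L q′
+-cong {p} {p′} {q} {q′} (≈-coeffs e) (≈-coeffs f) = ≈-coeffs λ i j →
  trans (coeff-++ p q i j) (trans (cong₂ ℚ._+_ (e i j) (f i j)) (sym (coeff-++ p′ q′ i j)))

+-assoc : ∀ p q r → (p +L q) +L r ≈ p +L (q +L r)
+-assoc p q r = ≡⇒≈ (ListP.++-assoc p q r)

+-comm : ∀ p q → p +L q ≈ q +L p
+-comm p q = ≈-coeffs λ i j → trans (coeff-++ p q i j)
  (trans (ℚP.+-comm (coeff p i j) (coeff q i j)) (sym (coeff-++ q p i j)))

+-identityʳ : ∀ p → p +L 0L ≈ p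
+-identityʳ p = ≡⇒≈ (ListP.++-identityʳ p)

neg-cong : ∀ {p q} → p ≈ q → -L p ≈ -L q
neg-cong {p} {q} (≈-coeffs e) = ≈-coeffs λ i j →
  trans (coeff-neg p i j) (trans (cong ℚ.-_ (e i j)) (sym (coeff-neg q i j)))

+-inverseˡ : ∀ p → (-L p) +L p ≈ 0L
+-inverseˡ p = ≈-coeffs λ i j → trans (coeff-++ (-L p) p i j)
  (trans (cong (ℚ._+ coeff p i j) (coeff-neg p i j)) (ℚP.+-inverseˡ (coeff p i j)))

+-inverseʳ : ∀ p → p +L (-L p) ≈ 0L
+-inverseʳ p = ≈-trans (+-comm p (-L p)) (+-inverseˡ p)

*-comm : ∀ p q → p *L q ≈ q *L p
*-comm p q = ≈-coeffs λ i j → begin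
  coeff (p *L q) i j             ≡⟨ coeff-*L p q i j ⟩
  convolve p (coeff q) i j       ≡⟨ convolve-cong p (coeff≡convolve-δ q) i j ⟩
  convolve p (convolve q δ) i j  ≡⟨ convolve-comm p q δ i j ⟩
  convolve q (convolve p δ) i j  ≡⟨ convolve-cong q (coeff≡convolve-δ p) i j ⟨
  convolve q (coeff p) i j       ≡⟨ coeff-*L q p i j ⟨
  coeff (q *L p) i j             ∎
  where open ≡-Reasoning

*-congʳ : ∀ p {q q′} → q ≈ q′ → p *L q ≈ p *L q′
*-congʳ p {q} {q′} (≈-coeffs e) = ≈-coeffs λ i j →
  trans (coeff-*L p q i j) (trans (convolve-cong p e i j) (sym (coeff-*L p q′ i j)))

*-congˡ : ∀ {p p′} q → p ≈ p′ → p *L q ≈ p′ *L q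
*-congˡ {p} {p′} q e = ≈-trans (*-comm p q) (≈-trans (*-congʳ q e) (*-comm q p′))

*-cong : ∀ {p p′ q q′} → p ≈ p′ → q ≈ q′ → p *L q ≈ p′ *L q′
*-cong {p} {p′} {q} e f = ≈-trans (*-congˡ q e) (*-congʳ p′ f)

*-assoc : ∀ p q r → (p *L q) *L r ≈ p *L (q *L r)
*-assoc p q r = ≈-coeffs λ i j → begin
  coeff ((p *L q) *L r) i j              ≡⟨ coeff-*L (p *L q) r i j ⟩
  convolve (p *L q) (coeff r) i j        ≡⟨ convolve-*L p q (coeff r) i j ⟩
  convolve p (convolve q (coeff r)) i j  ≡⟨ convolve-cong p (coeff-*L q r) i j ⟨
  convolve p (coeff (q *L r)) i j        ≡⟨ coeff-*L p (q *L r) i j ⟨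
  coeff (p *L (q *L r)) i j              ∎
  where open ≡-Reasoning

*-identityˡ : ∀ p → 1L *L p ≈ p
*-identityˡ p = ≈-coeffs λ i j → begin
  coeff (1L *L p) i j                            ≡⟨ coeff-*L 1L p i j ⟩
  1ℚ ℚ.* coeff p (i ℤ.- + 0) (j ℤ.- + 0) ℚ.+ 0ℚ  ≡⟨ ℚP.+-identityʳ _ ⟩
  1ℚ ℚ.* coeff p (i ℤ.- + 0) (j ℤ.- + 0)         ≡⟨ ℚP.*-identityˡ _ ⟩
  coeff p (i ℤ.- + 0) (j ℤ.- + 0)                ≡⟨ cong₂ (coeff p) (ℤP.+-identityʳ i) (ℤP.+-identityʳ j) ⟩
  coeff p i j                                    ∎
  where open ≡-Reasoning

*-identityʳ : ∀ p → p *L 1L ≈ p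
*-identityʳ p = ≈-trans (*-comm p 1L) (*-identityˡ p)

*-distribˡ-+ : ∀ p q r → p *L (q +L r) ≈ p *L q +L p *L r
*-distribˡ-+ p q r = ≈-coeffs λ i j → begin
  coeff (p *L (q +L r)) i j                             ≡⟨ coeff-*L p (q +L r) i j ⟩
  convolve p (coeff (q +L r)) i j                       ≡⟨ convolve-cong p (coeff-++ q r) i j ⟩
  convolve p (λ i j → coeff q i j ℚ.+ coeff r i j) i j  ≡⟨ convolve-+ p (coeff q) (coeff r) i j ⟩
  convolve p (coeff q) i j ℚ.+ convolve p (coeff r) i j ≡⟨ cong₂ ℚ._+_ (coeff-*L p q i j) (coeff-*L p r i j) ⟨
  coeff (p *L q) i j ℚ.+ coeff (p *L r) i j             ≡⟨ coeff-++ (p *L q) (p *L r) i j ⟨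
  coeff (p *L q +L p *L r) i j                          ∎
  where open ≡-Reasoning

*-distribʳ-+ : ∀ p q r → (q +L r) *L p ≈ q *L p +L r *L p
*-distribʳ-+ p q r = ≈-trans (*-comm (q +L r) p)
  (≈-trans (*-distribˡ-+ p q r) (+-cong (*-comm p q) (*-comm p r)))

LRing : CommutativeRing 0ℓ 0ℓ
LRing = record
  { Carrier = LPoly ; _≈_ = _≈_ ; _+_ = _+L_ ; _*_ = _*L_ ; -_ = -L_ ; 0# = 0L ; 1# = 1L
  ; isCommutativeRing = record
    { isRing = record
      { +-isAbelianGroup = record
        { isGroup = record
          { isMonoid = record
            { isSemigroup = record
              { isMagma = record
                { isEquivalence = record { refl = ≈-refl ; sym = ≈-sym ; trans = ≈-trans }
                ; ∙-cong = +-cong }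
              ; assoc = +-assoc }
            ; identity = (λ p → ≈-refl) , +-identityʳ }
          ; inverse = +-inverseˡ , +-inverseʳ
          ; ⁻¹-cong = neg-cong }
        ; comm = +-comm }
      ; *-cong = *-cong
      ; *-assoc = *-assoc
      ; *-identity = *-identityˡ , *-identityʳ
      ; distrib = *-distribˡ-+ , *-distribʳ-+ }
    ; *-comm = *-comm } }


module LPolySolver = CommutativeRingSolver LRing
open CauchyProduct LRing
open Algebra.Properties.Semiring.Mult (CommutativeRing.semiring LRing) using (_×_)
module ≈-Reasoning = Relation.Binary.Reasoning.Setoid (CommutativeRing.setoid LRing)
open Algebra.Properties.Ring (CommutativeRing.ring LRing) using (-‿distribˡ-*; -‿distribʳ-*; -‿involutive)

·L-cong : ∀ r {p q} → p ≈ q → r ·L p ≈ r ·L q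
·L-cong r {p} {q} (≈-coeffs e) = ≈-coeffs λ i j →
  trans (coeff-·L r p i j) (trans (cong (r ℚ.*_) (e i j)) (sym (coeff-·L r q i j)))

·L-assoc : ∀ r s p → r ·L (s ·L p) ≈ (r ℚ.* s) ·L p
·L-assoc r s p = ≈-coeffs λ i j → begin
  coeff (r ·L (s ·L p)) i j   ≡⟨ coeff-·L r (s ·L p) i j ⟩
  r ℚ.* coeff (s ·L p) i j    ≡⟨ cong (r ℚ.*_) (coeff-·L s p i j) ⟩
  r ℚ.* (s ℚ.* coeff p i j)   ≡⟨ ℚP.*-assoc r s (coeff p i j) ⟨
  (r ℚ.* s) ℚ.* coeff p i j   ≡⟨ coeff-·L (r ℚ.* s) p i j ⟨
  coeff ((r ℚ.* s) ·L p) i j  ∎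
  where open ≡-Reasoning

·L-identity : ∀ p → 1ℚ ·L p ≈ p
·L-identity p = ≈-coeffs λ i j → trans (coeff-·L 1ℚ p i j) (ℚP.*-identityˡ (coeff p i j))

·L-distrib-+ : ∀ r s p → (r ℚ.+ s) ·L p ≈ r ·L p +L s ·L p
·L-distrib-+ r s p = ≈-coeffs λ i j → begin
  coeff ((r ℚ.+ s) ·L p) i j                      ≡⟨ coeff-·L (r ℚ.+ s) p i j ⟩
  (r ℚ.+ s) ℚ.* coeff p i j                       ≡⟨ ℚP.*-distribʳ-+ (coeff p i j) r s ⟩
  r ℚ.* coeff p i j ℚ.+ s ℚ.* coeff p i j         ≡⟨ cong₂ ℚ._+_ (coeff-·L r p i j) (coeff-·L s p i j) ⟨
  coeff (r ·L p) i j ℚ.+ coeff (s ·L p) i j       ≡⟨ coeff-++ (r ·L p) (s ·L p) i j ⟨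
  coeff (r ·L p +L s ·L p) i j                    ∎
  where open ≡-Reasoning

convolve-·L : ∀ r p g i j → convolve (r ·L p) g i j ≡ r ℚ.* convolve p g i j
convolve-·L r []                g i j = sym (ℚP.*-zeroʳ r)
convolve-·L r ((c , a , b) ∷ p) g i j =
  trans (cong₂ ℚ._+_ (ℚP.*-assoc r c (g (i ℤ.- a) (j ℤ.- b))) (convolve-·L r p g i j))
        (sym (ℚP.*-distribˡ-+ r (c ℚ.* g (i ℤ.- a) (j ℤ.- b)) (convolve p g i j)))

·L-*L : ∀ r p q → (r ·L p) *L q ≈ r ·L (p *L q)
·L-*L r p q = ≈-coeffs λ i j → begin
  coeff ((r ·L p) *L q) i j       ≡⟨ coeff-*L (r ·L p) q i j ⟩
  convolve (r ·L p) (coeff q) i j ≡⟨ convolve-·L r p (coeff q) i j ⟩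
  r ℚ.* convolve p (coeff q) i j  ≡⟨ cong (r ℚ.*_) (coeff-*L p q i j) ⟨
  r ℚ.* coeff (p *L q) i j        ≡⟨ coeff-·L r (p *L q) i j ⟨
  coeff (r ·L (p *L q)) i j       ∎
  where open ≡-Reasoning

·L-neg : ∀ r p → r ·L (-L p) ≈ -L (r ·L p)
·L-neg r p = ≈-coeffs λ i j → begin
  coeff (r ·L (-L p)) i j     ≡⟨ coeff-·L r (-L p) i j ⟩
  r ℚ.* coeff (-L p) i j      ≡⟨ cong (r ℚ.*_) (coeff-neg p i j) ⟩
  r ℚ.* ℚ.- coeff p i j       ≡⟨ ℚP.neg-distribʳ-* r (coeff p i j) ⟨
  ℚ.- (r ℚ.* coeff p i j)     ≡⟨ cong ℚ.-_ (coeff-·L r p i j) ⟨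
  ℚ.- coeff (r ·L p) i j      ≡⟨ coeff-neg (r ·L p) i j ⟨
  coeff (-L (r ·L p)) i j     ∎
  where open ≡-Reasoning

×≈·L : ∀ n p → suc n × p ≈ (+ suc n) /1 ·L p
×≈·L zero    p = ≈-trans (+-identityʳ p) (≈-sym (·L-identity p))
×≈·L (suc n) p = ≈-trans (+-cong (≈-sym (·L-identity p)) (×≈·L n p))
  (≈-sym (≈-trans (≡⇒≈ (cong (_·L p) (/1-homo-+ (+ 1) (+ suc n)))) (·L-distrib-+ 1ℚ ((+ suc n) /1) p)))

1/suc·L-× : ∀ n p → ((+ 1) ℚ./ suc n) ·L (suc n × p) ≈ p
1/suc·L-× n p = begin
  ((+ 1) ℚ./ suc n) ·L (suc n × p)              ≈⟨ ·L-cong ((+ 1) ℚ./ suc n) (×≈·L n p) ⟩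
  ((+ 1) ℚ./ suc n) ·L ((+ suc n) /1 ·L p)      ≈⟨ ·L-assoc ((+ 1) ℚ./ suc n) ((+ suc n) /1) p ⟩
  (((+ 1) ℚ./ suc n) ℚ.* (+ suc n) /1) ·L p     ≡⟨ cong (_·L p) (1/suc*suc≡1 n) ⟩
  1ℚ ·L p                                       ≈⟨ ·L-identity p ⟩
  p                                             ∎
  where open ≈-Reasoning

-- The derivation D

D-++ : ∀ p q → D (p ++ q) ≡ D p ++ D q
D-++ []      q = refl
D-++ (m ∷ p) q = trans (cong (Dmono m ++_) (D-++ p q)) (sym (ListP.++-assoc (Dmono m) (D p) (D q)))

if-≟-scale : ∀ {a i : ℤ} (a≟i : Dec (a ≡ i)) t c (f : ℤ → ℚ) →
  (if does a≟i ∧ t then c ℚ.* f a else 0ℚ) ≡ f i ℚ.* (if does a≟i ∧ t then c else 0ℚ)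
if-≟-scale (yes refl) true  c f = ℚP.*-comm c (f _)
if-≟-scale (yes refl) false c f = sym (ℚP.*-zeroʳ (f _))
if-≟-scale {i = i} (no _) t c f = sym (ℚP.*-zeroʳ (f i))

if-≟-scaleʳ : ∀ t {b j : ℤ} (b≟j : Dec (b ≡ j)) c (f : ℤ → ℚ) →
  (if t ∧ does b≟j then c ℚ.* f b else 0ℚ) ≡ f j ℚ.* (if t ∧ does b≟j then c else 0ℚ)
if-≟-scaleʳ t b≟j c f rewrite BoolP.∧-comm t (does b≟j) = if-≟-scale b≟j t c f

coeff-Dmono : ∀ m i j → coeff (Dmono m) i j ≡
  (i /1) ℚ.* coeff (mono m) i (j ℤ.- + 1) ℚ.+ ((j ℤ.+ + 1) /1) ℚ.* coeff (mono m) (i ℤ.- + 2) (j ℤ.+ + 1)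
coeff-Dmono (c , a , b) i j
  rewrite does-≟-translate b j (+ 1) | does-≟-translate a i (+ 2) | does-≟-translate b j (ℤ.- + 1) =
  trans (cong₂ (λ u v → u ℚ.+ (v ℚ.+ 0ℚ))
               (if-≟-scale (a ℤ.≟ i) (does (b ℤ.≟ j ℤ.- + 1)) c _/1)
               (if-≟-scaleʳ (does (a ℤ.≟ i ℤ.- + 2)) (b ℤ.≟ j ℤ.+ + 1) c _/1))
        (pad (i /1) ((j ℤ.+ + 1) /1) _ _)
  where
  open ℚSolver
  pad : ∀ I J x y → I ℚ.* x ℚ.+ (J ℚ.* y ℚ.+ 0ℚ) ≡ I ℚ.* (x ℚ.+ 0ℚ) ℚ.+ J ℚ.* (y ℚ.+ 0ℚ)
  pad = solve 4 (λ I J x y → I :* x :+ (J :* y :+ con 0ℚ) := I :* (x :+ con 0ℚ) :+ J :* (y :+ con 0ℚ)) refl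

D-coeff : ∀ p i j → coeff (D p) i j ≡
  (i /1) ℚ.* coeff p i (j ℤ.- + 1) ℚ.+ ((j ℤ.+ + 1) /1) ℚ.* coeff p (i ℤ.- + 2) (j ℤ.+ + 1)
D-coeff []      i j = sym (cong₂ ℚ._+_ (ℚP.*-zeroʳ (i /1)) (ℚP.*-zeroʳ ((j ℤ.+ + 1) /1)))
D-coeff (m ∷ p) i j = begin
  coeff (Dmono m ++ D p) i j
    ≡⟨ coeff-++ (Dmono m) (D p) i j ⟩
  coeff (Dmono m) i j ℚ.+ coeff (D p) i j
    ≡⟨ cong₂ ℚ._+_ (coeff-Dmono m i j) (D-coeff p i j) ⟩
  (I ℚ.* coeff (mono m) i j₋ ℚ.+ J ℚ.* coeff (mono m) i₋ j₊) ℚ.+ (I ℚ.* coeff p i j₋ ℚ.+ J ℚ.* coeff p i₋ j₊)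
    ≡⟨ regroup I J _ _ _ _ ⟩
  I ℚ.* (coeff (mono m) i j₋ ℚ.+ coeff p i j₋) ℚ.+ J ℚ.* (coeff (mono m) i₋ j₊ ℚ.+ coeff p i₋ j₊)
    ≡⟨ cong₂ (λ u v → I ℚ.* u ℚ.+ J ℚ.* v) (coeff-++ (mono m) p i j₋) (coeff-++ (mono m) p i₋ j₊) ⟨
  I ℚ.* coeff (m ∷ p) i j₋ ℚ.+ J ℚ.* coeff (m ∷ p) i₋ j₊ ∎
  where
  open ≡-Reasoning
  open ℚSolver using (solve; _:+_; _:*_; _:=_)
  I = i /1
  J = (j ℤ.+ + 1) /1
  i₋ = i ℤ.- + 2
  j₋ = j ℤ.- + 1
  j₊ = j ℤ.+ + 1
  regroup : ∀ I J t u x y →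
    (I ℚ.* t ℚ.+ J ℚ.* u) ℚ.+ (I ℚ.* x ℚ.+ J ℚ.* y) ≡ I ℚ.* (t ℚ.+ x) ℚ.+ J ℚ.* (u ℚ.+ y)
  regroup = solve 6 (λ I J t u x y →
    (I :* t :+ J :* u) :+ (I :* x :+ J :* y) := I :* (t :+ x) :+ J :* (u :+ y)) refl

D-cong : ∀ {p q} → p ≈ q → D p ≈ D q
D-cong {p} {q} (≈-coeffs e) = ≈-coeffs λ i j → trans (D-coeff p i j)
  (trans (cong₂ (λ u v → (i /1) ℚ.* u ℚ.+ ((j ℤ.+ + 1) /1) ℚ.* v)
                (e i (j ℤ.- + 1)) (e (i ℤ.- + 2) (j ℤ.+ + 1)))
         (sym (D-coeff q i j)))

D-·L : ∀ r p → D (r ·L p) ≈ r ·L D p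
D-·L r p = ≈-coeffs λ i j → begin
  coeff (D (r ·L p)) i j
    ≡⟨ D-coeff (r ·L p) i j ⟩
  (i /1) ℚ.* coeff (r ·L p) i (j ℤ.- + 1) ℚ.+ ((j ℤ.+ + 1) /1) ℚ.* coeff (r ·L p) (i ℤ.- + 2) (j ℤ.+ + 1)
    ≡⟨ cong₂ (λ u v → (i /1) ℚ.* u ℚ.+ ((j ℤ.+ + 1) /1) ℚ.* v) (coeff-·L r p i (j ℤ.- + 1))
                                                             (coeff-·L r p (i ℤ.- + 2) (j ℤ.+ + 1)) ⟩
  (i /1) ℚ.* (r ℚ.* _) ℚ.+ ((j ℤ.+ + 1) /1) ℚ.* (r ℚ.* _)
    ≡⟨ factor (i /1) ((j ℤ.+ + 1) /1) r (coeff p i (j ℤ.- + 1)) (coeff p (i ℤ.- + 2) (j ℤ.+ + 1)) ⟩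
  r ℚ.* ((i /1) ℚ.* coeff p i (j ℤ.- + 1) ℚ.+ ((j ℤ.+ + 1) /1) ℚ.* coeff p (i ℤ.- + 2) (j ℤ.+ + 1))
    ≡⟨ cong (r ℚ.*_) (D-coeff p i j) ⟨
  r ℚ.* coeff (D p) i j
    ≡⟨ coeff-·L r (D p) i j ⟨
  coeff (r ·L D p) i j ∎
  where
  open ≡-Reasoning
  open ℚSolver using (solve; _:+_; _:*_; _:=_)
  factor : ∀ I J r x y → I ℚ.* (r ℚ.* x) ℚ.+ J ℚ.* (r ℚ.* y) ≡ r ℚ.* (I ℚ.* x ℚ.+ J ℚ.* y)
  factor = solve 5 (λ I J r x y → I :* (r :* x) :+ J :* (r :* y) := r :* (I :* x :+ J :* y)) refl

mono-merge : ∀ {x y z a b a₁ b₁ a₂ b₂} → x ℚ.+ y ≡ z → a₁ ≡ a → b₁ ≡ b → a₂ ≡ a → b₂ ≡ b →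
             mono (x , a₁ , b₁) +L mono (y , a₂ , b₂) ≈ mono (z , a , b)
mono-merge {x} {y} {a = a} {b} refl refl refl refl refl = ≈-coeffs λ i j → merge (matches a b i j)
  where
  open ℚSolver
  merge : ∀ t → (if t then x else 0ℚ) ℚ.+ ((if t then y else 0ℚ) ℚ.+ 0ℚ) ≡ (if t then x ℚ.+ y else 0ℚ) ℚ.+ 0ℚ
  merge true  = solve 2 (λ x y → x :+ (y :+ con 0ℚ) := (x :+ y) :+ con 0ℚ) refl x y
  merge false = refl

mono-zero : ∀ a b → mono (0ℚ , a , b) ≈ 0L
mono-zero a b = ≈-coeffs λ i j → zero-if (matches a b i j)
  where
  zero-if : ∀ t → (if t then 0ℚ else 0ℚ) ℚ.+ 0ℚ ≡ 0ℚ
  zero-if true  = refl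
  zero-if false = refl

drop-zeroˡ : ∀ a b p → (0ℚ , a , b) ∷ p ≈ p
drop-zeroˡ a b p = +-cong (mono-zero a b) (≈-refl {p})

drop-zeroʳ : ∀ m a b → m ∷ (0ℚ , a , b) ∷ [] ≈ mono m
drop-zeroʳ m a b = ≈-trans (+-cong (≈-refl {mono m}) (mono-zero a b)) (+-identityʳ (mono m))

+-shiftˡ : ∀ x y k → x ℤ.+ k ℤ.+ y ≡ x ℤ.+ y ℤ.+ k
+-shiftˡ = ℤSolver.solve-∀

+-shiftʳ : ∀ x y k → x ℤ.+ (y ℤ.+ k) ≡ x ℤ.+ y ℤ.+ k
+-shiftʳ = ℤSolver.solve-∀

leibniz-mono : ∀ m n → D (mono m *L mono n) ≈ D (mono m) *L mono n +L mono m *L D (mono n)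
leibniz-mono (c , a , b) (d , a′ , b′) = ≈-sym (begin
  mono P₁ +L (mono P₂ +L (mono Q₁ +L mono Q₂))
    ≈⟨ +-assoc (mono P₁) (mono P₂) (mono Q₁ +L mono Q₂) ⟨
  (mono P₁ +L mono P₂) +L (mono Q₁ +L mono Q₂)
    ≈⟨ interchange (mono P₁) (mono P₂) (mono Q₁) (mono Q₂) ⟩
  (mono P₁ +L mono Q₁) +L (mono P₂ +L mono Q₂)
    ≈⟨ +-cong (mono-merge (coefficient a a′) refl (+-shiftˡ b b′ (+ 1))
                          refl (+-shiftʳ b b′ (+ 1)))
              (mono-merge (coefficient b b′) (+-shiftˡ a a′ (+ 2)) (+-shiftˡ b b′ (ℤ.- + 1))
                          (+-shiftʳ a a′ (+ 2)) (+-shiftʳ b b′ (ℤ.- + 1))) ⟩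
  D (mono (c , a , b) *L mono (d , a′ , b′)) ∎)
  where
  open ≈-Reasoning
  open Algebra.Properties.CommutativeSemigroup (CommutativeRing.+-commutativeSemigroup LRing)
    using (interchange)
  open ℚSolver using (solve; _:+_; _:*_; _:=_)
  P₁ = (c ℚ.* (a /1) ℚ.* d , a ℤ.+ a′ , b ℤ.+ + 1 ℤ.+ b′)
  P₂ = (c ℚ.* (b /1) ℚ.* d , a ℤ.+ + 2 ℤ.+ a′ , b ℤ.- + 1 ℤ.+ b′)
  Q₁ = (c ℚ.* (d ℚ.* (a′ /1)) , a ℤ.+ a′ , b ℤ.+ (b′ ℤ.+ + 1))
  Q₂ = (c ℚ.* (d ℚ.* (b′ /1)) , a ℤ.+ (a′ ℤ.+ + 2) , b ℤ.+ (b′ ℤ.- + 1))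
  distribute : ∀ c d x y → c ℚ.* x ℚ.* d ℚ.+ c ℚ.* (d ℚ.* y) ≡ c ℚ.* d ℚ.* (x ℚ.+ y)
  distribute = solve 4 (λ c d x y → c :* x :* d :+ c :* (d :* y) := c :* d :* (x :+ y)) refl
  coefficient : ∀ u u′ → c ℚ.* (u /1) ℚ.* d ℚ.+ c ℚ.* (d ℚ.* (u′ /1)) ≡ c ℚ.* d ℚ.* ((u ℤ.+ u′) /1)
  coefficient u u′ = trans (distribute c d (u /1) (u′ /1)) (cong (c ℚ.* d ℚ.*_) (sym (/1-homo-+ u u′)))

leibniz-monoˡ : ∀ m q → D (mono m *L q) ≈ D (mono m) *L q +L mono m *L D q
leibniz-monoˡ m []      = ≈-refl
leibniz-monoˡ m (n ∷ q) = begin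
  D (mono m *L mono n +L mono m *L q)
    ≡⟨ D-++ (mono m *L mono n) (mono m *L q) ⟩
  D (mono m *L mono n) +L D (mono m *L q)
    ≈⟨ +-cong (leibniz-mono m n) (leibniz-monoˡ m q) ⟩
  (D (mono m) *L mono n +L mono m *L D (mono n)) +L (D (mono m) *L q +L mono m *L D q)
    ≈⟨ solve 6 (λ x dx y dy z dz → (dx :* y :+ x :* dy) :+ (dx :* z :+ x :* dz)
                                  := dx :* (y :+ z) :+ x :* (dy :+ dz))
               ≈-refl (mono m) (D (mono m)) (mono n) (D (mono n)) q (D q) ⟩
  D (mono m) *L (mono n +L q) +L mono m *L (D (mono n) +L D q)
    ≡⟨ cong (λ z → D (mono m) *L (n ∷ q) +L mono m *L z) (D-++ (mono n) q) ⟨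
  D (mono m) *L (n ∷ q) +L mono m *L D (n ∷ q) ∎
  where
  open ≈-Reasoning
  open LPolySolver using (solve; _:+_; _:*_; _:=_)

leibniz : ∀ p q → D (p *L q) ≈ D p *L q +L p *L D q
leibniz []      q = ≈-refl
leibniz (m ∷ p) q = begin
  D ((mono m +L p) *L q)
    ≈⟨ D-cong (*-distribʳ-+ q (mono m) p) ⟩
  D (mono m *L q +L p *L q)
    ≡⟨ D-++ (mono m *L q) (p *L q) ⟩
  D (mono m *L q) +L D (p *L q)
    ≈⟨ +-cong (leibniz-monoˡ m q) (leibniz p q) ⟩
  (D (mono m) *L q +L mono m *L D q) +L (D p *L q +L p *L D q)
    ≈⟨ solve 6 (λ x dx y dy z dz → (dx :* z :+ x :* dz) :+ (dy :* z :+ y :* dz)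
                                  := (dx :+ dy) :* z :+ (x :+ y) :* dz)
               ≈-refl (mono m) (D (mono m)) p (D p) q (D q) ⟩
  (D (mono m) +L D p) *L q +L (mono m +L p) *L D q
    ≡⟨ cong (λ z → z *L q +L (m ∷ p) *L D q) (D-++ (mono m) p) ⟨
  D (m ∷ p) *L q +L (m ∷ p) *L D q ∎
  where
  open ≈-Reasoning
  open LPolySolver using (solve; _:+_; _:*_; _:=_)

D-isDerivation : IsDerivation D
D-isDerivation = record
  { d-+     = λ p q → ≡⇒≈ (D-++ p q)
  ; leibniz = leibniz
  }

D-neg : ∀ p → D (-L p) ≈ -L D p
D-neg p = inverseˡ-unique (D (-L p)) (D p) (≈-trans (≡⇒≈ (sym (D-++ (-L p) p))) (D-cong (+-inverseˡ p)))
  where open Algebra.Properties.Group (CommutativeRing.+-group LRing) using (inverseˡ-unique)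

leibniz-constˡ : ∀ c → D c ≈ 0L → ∀ q → D (c *L q) ≈ c *L D q
leibniz-constˡ c Dc≈0 q = begin
  D (c *L q)            ≈⟨ leibniz c q ⟩
  D c *L q +L c *L D q  ≈⟨ +-cong (*-congˡ q Dc≈0) ≈-refl ⟩
  0L *L q +L c *L D q   ≡⟨⟩
  c *L D q              ∎
  where open ≈-Reasoning

D-1 : D 1L ≈ 0L
D-1 = ≈-trans (drop-zeroˡ (+ 0) (+ 1) _) (mono-zero (+ 2) (ℤ.- + 1))

D^-cong : ∀ n {p q} → p ≈ q → D^ n p ≈ D^ n q
D^-cong zero    p≈q = p≈q
D^-cong (suc n) p≈q = D-cong (D^-cong n p≈q)

x⁻¹ : LPoly
x⁻¹ = mono (1ℚ , ℤ.- + 1 , + 0)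

x*x⁻¹≈1 : xL *L x⁻¹ ≈ 1L
x*x⁻¹≈1 = ≈-refl

D-x : D xL ≈ xL *L yL
D-x = drop-zeroʳ _ (+ 3) (ℤ.- + 1)

D-y : D yL ≈ xL *L xL
D-y = drop-zeroˡ (+ 0) (+ 2) _

D-x⁻¹ : D x⁻¹ ≈ -L (yL *L x⁻¹)
D-x⁻¹ = drop-zeroʳ _ (+ 1) (ℤ.- + 1)

D-s² : D s² ≈ 0L
D-s² = begin
  D (yL *L yL -L xL *L xL)
    ≡⟨ D-++ (yL *L yL) (-L (xL *L xL)) ⟩
  D (yL *L yL) +L D (-L (xL *L xL))
    ≈⟨ +-cong (leibniz yL yL) (≈-trans (D-neg (xL *L xL)) (neg-cong (leibniz xL xL))) ⟩
  (D yL *L yL +L yL *L D yL) -L (D xL *L xL +L xL *L D xL)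
    ≈⟨ +-cong (+-cong (*-congˡ yL D-y) (*-congʳ yL D-y))
              (neg-cong (+-cong (*-congˡ xL D-x) (*-congʳ xL D-x))) ⟩
  ((xL *L xL) *L yL +L yL *L (xL *L xL)) -L ((xL *L yL) *L xL +L xL *L (xL *L yL))
    ≈⟨ +-cong (≈-refl {(xL *L xL) *L yL +L yL *L (xL *L xL)}) (neg-cong (≈-sym x²y+yx²≈xyx+x²y)) ⟩
  ((xL *L xL) *L yL +L yL *L (xL *L xL)) -L ((xL *L xL) *L yL +L yL *L (xL *L xL))
    ≈⟨ +-inverseʳ ((xL *L xL) *L yL +L yL *L (xL *L xL)) ⟩
  0L ∎
  where
  open ≈-Reasoning
  open LPolySolver using (solve; _:+_; _:*_; _:=_)
  x²y+yx²≈xyx+x²y : (xL *L xL) *L yL +L yL *L (xL *L xL) ≈ (xL *L yL) *L xL +L xL *L (xL *L yL)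
  x²y+yx²≈xyx+x²y = solve 2 (λ x y → (x :* x) :* y :+ y :* (x :* x) := (x :* y) :* x :+ x :* (x :* y))
                            ≈-refl xL yL

-- Both sides compute to the same two monomials, x − y²/x.
D-yx⁻¹ : D (yL *L x⁻¹) ≈ -L (s² *L x⁻¹)
D-yx⁻¹ = ≈-refl

D-s²^ : ∀ k → D (s² ^L k) ≈ 0L
D-s²^ zero    = D-1
D-s²^ (suc k) = ≈-trans (leibniz-constˡ s² D-s² (s² ^L k)) (*-congʳ s² (D-s²^ k))

mutual
  D^-x⁻¹-even : ∀ k → D^ (k ℕ.* 2) x⁻¹ ≈ s² ^L k *L x⁻¹
  D^-x⁻¹-even zero    = ≈-sym (*-identityˡ x⁻¹)
  D^-x⁻¹-even (suc k) = begin
    D (D^ (suc (k ℕ.* 2)) x⁻¹)              ≈⟨ D-cong (D^-x⁻¹-odd k) ⟩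
    D (-L (s² ^L k *L (yL *L x⁻¹)))         ≈⟨ D-neg (s² ^L k *L (yL *L x⁻¹)) ⟩
    -L D (s² ^L k *L (yL *L x⁻¹))           ≈⟨ neg-cong (leibniz-constˡ (s² ^L k) (D-s²^ k) (yL *L x⁻¹)) ⟩
    -L (s² ^L k *L D (yL *L x⁻¹))           ≈⟨ neg-cong (*-congʳ (s² ^L k) D-yx⁻¹) ⟩
    -L (s² ^L k *L (-L (s² *L x⁻¹)))        ≈⟨ neg-cong (-‿distribʳ-* (s² ^L k) (s² *L x⁻¹)) ⟨
    -L (-L (s² ^L k *L (s² *L x⁻¹)))        ≈⟨ -‿involutive (s² ^L k *L (s² *L x⁻¹)) ⟩
    s² ^L k *L (s² *L x⁻¹)                  ≈⟨ rearrange (s² ^L k) s² x⁻¹ ⟩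
    (s² *L s² ^L k) *L x⁻¹                  ∎
    where
    open ≈-Reasoning
    open LPolySolver using (solve; _:*_; _:=_)
    rearrange : ∀ S s w → S *L (s *L w) ≈ (s *L S) *L w
    rearrange = solve 3 (λ S s w → S :* (s :* w) := (s :* S) :* w) ≈-refl

  D^-x⁻¹-odd : ∀ k → D^ (suc (k ℕ.* 2)) x⁻¹ ≈ -L (s² ^L k *L (yL *L x⁻¹))
  D^-x⁻¹-odd k = begin
    D (D^ (k ℕ.* 2) x⁻¹)              ≈⟨ D-cong (D^-x⁻¹-even k) ⟩
    D (s² ^L k *L x⁻¹)                ≈⟨ leibniz-constˡ (s² ^L k) (D-s²^ k) x⁻¹ ⟩
    s² ^L k *L D x⁻¹                  ≈⟨ *-congʳ (s² ^L k) D-x⁻¹ ⟩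
    s² ^L k *L (-L (yL *L x⁻¹))       ≈⟨ -‿distribʳ-* (s² ^L k) (yL *L x⁻¹) ⟨
    -L (s² ^L k *L (yL *L x⁻¹))       ∎
    where open ≈-Reasoning

Gen-cong : ∀ {p q} → p ≈ q → ∀ n → Gen p n ≈ Gen q n
Gen-cong p≈q n = ·L-cong (invFact n) (D^-cong n p≈q)

Gen-zero : ∀ h → Gen h 0 ≈ h
Gen-zero = ·L-identity

Gen-D : ∀ h n → D (Gen h n) ≈ suc n × Gen h (suc n)
Gen-D h n = begin
  D (invFact n ·L D^ n h)                             ≈⟨ D-·L (invFact n) (D^ n h) ⟩
  invFact n ·L D^ (suc n) h                           ≡⟨ cong (_·L D^ (suc n) h) (invFact-suc n) ⟩
  ((+ suc n) /1 ℚ.* invFact (suc n)) ·L D^ (suc n) h  ≈⟨ ·L-assoc ((+ suc n) /1) (invFact (suc n)) _ ⟨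
  (+ suc n) /1 ·L Gen h (suc n)                       ≈⟨ ×≈·L n (Gen h (suc n)) ⟨
  suc n × Gen h (suc n)                               ∎
  where open ≈-Reasoning

Gen-*L : ∀ f g n → Gen (f *L g) n ≈ cauchy (Gen f) (Gen g) n
Gen-*L f g zero    = ≈-trans (Gen-zero (f *L g)) (≈-sym (*-cong (Gen-zero f) (Gen-zero g)))
Gen-*L f g (suc n) = begin
  Gen (f *L g) (suc n)                          ≈⟨ 1/suc·L-× n (Gen (f *L g) (suc n)) ⟨
  r ·L (suc n × Gen (f *L g) (suc n))           ≈⟨ ·L-cong r (Gen-D (f *L g) n) ⟨
  r ·L D (Gen (f *L g) n)                       ≈⟨ ·L-cong r (D-cong (Gen-*L f g n)) ⟩
  r ·L D (cauchy A B n)                         ≈⟨ ·L-cong r (cauchy-derivation D-isDerivation n A B) ⟩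
  r ·L (cauchy (D ∘ A) B n +L cauchy A (D ∘ B) n)
    ≈⟨ ·L-cong r (+-cong (cauchy-cong n (Gen-D f) (λ _ → ≈-refl)) (cauchy-cong n (λ _ → ≈-refl) (Gen-D g))) ⟩
  r ·L (cauchy (∂ A) B n +L cauchy A (∂ B) n)   ≈⟨ ·L-cong r (cauchy-∂ n A B) ⟩
  r ·L (suc n × cauchy A B (suc n))             ≈⟨ 1/suc·L-× n (cauchy A B (suc n)) ⟩
  cauchy A B (suc n)                            ∎
  where
  open ≈-Reasoning
  r = (+ 1) ℚ./ suc n
  A = Gen f
  B = Gen g

Gen-1 : ∀ n → Gen 1L n ≈ constPS 1L n
Gen-1 zero    = Gen-zero 1L
Gen-1 (suc n) = ·L-cong (invFact (suc n)) (D^-1 n)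
  where
  D^-1 : ∀ n → D^ (suc n) 1L ≈ 0L
  D^-1 zero    = D-1
  D^-1 (suc n) = D-cong (D^-1 n)

-- The exponential generating function of 1/x

denominator : PS
denominator = coshS -PS (sinhS/s *PS yL)

even-*2 : ∀ k → even (k ℕ.* 2) ≡ true
even-*2 zero    = refl
even-*2 (suc k) rewrite even-*2 k = refl

half-*2 : ∀ k → k ℕ.* 2 ℕ./ 2 ≡ k
half-*2 k = ℕDivMod.m*n/n≡m k 2

half-suc-*2 : ∀ k → suc (k ℕ.* 2) ℕ./ 2 ≡ k
half-suc-*2 k = trans (ℕDivMod.+-distrib-/-∣ʳ 1 {k ℕ.* 2} {2} (ℕDiv.divides-refl k)) (half-*2 k)

even⊎odd : ∀ n → (∃[ k ] n ≡ k ℕ.* 2) ⊎ (∃[ k ] n ≡ suc (k ℕ.* 2))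
even⊎odd zero    = inj₁ (0 , refl)
even⊎odd (suc n) with even⊎odd n
... | inj₁ (k , refl) = inj₂ (k , refl)
... | inj₂ (k , refl) = inj₁ (suc k , refl)

Gen-x⁻¹-even : ∀ k → Gen x⁻¹ (k ℕ.* 2) ≈ denominator (k ℕ.* 2) *L x⁻¹
Gen-x⁻¹-even k rewrite even-*2 k | half-*2 k = begin
  F ·L D^ (k ℕ.* 2) x⁻¹        ≈⟨ ·L-cong F (D^-x⁻¹-even k) ⟩
  F ·L (s² ^L k *L x⁻¹)        ≈⟨ ·L-*L F (s² ^L k) x⁻¹ ⟨
  (F ·L s² ^L k) *L x⁻¹        ≈⟨ *-congˡ x⁻¹ (+-identityʳ (F ·L s² ^L k)) ⟨
  (F ·L s² ^L k +L 0L) *L x⁻¹  ∎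
  where
  open ≈-Reasoning
  F = invFact (k ℕ.* 2)

Gen-x⁻¹-odd : ∀ k → Gen x⁻¹ (suc (k ℕ.* 2)) ≈ denominator (suc (k ℕ.* 2)) *L x⁻¹
Gen-x⁻¹-odd k rewrite even-*2 k | half-suc-*2 k = begin
  F ·L D^ (suc (k ℕ.* 2)) x⁻¹           ≈⟨ ·L-cong F (D^-x⁻¹-odd k) ⟩
  F ·L (-L (s² ^L k *L (yL *L x⁻¹)))    ≈⟨ ·L-neg F (s² ^L k *L (yL *L x⁻¹)) ⟩
  -L (F ·L (s² ^L k *L (yL *L x⁻¹)))    ≈⟨ neg-cong (·L-*L F (s² ^L k) (yL *L x⁻¹)) ⟨
  -L ((F ·L s² ^L k) *L (yL *L x⁻¹))    ≈⟨ neg-cong (*-assoc (F ·L s² ^L k) yL x⁻¹) ⟨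
  -L ((F ·L s² ^L k) *L yL *L x⁻¹)      ≈⟨ -‿distribˡ-* ((F ·L s² ^L k) *L yL) x⁻¹ ⟩
  -L ((F ·L s² ^L k) *L yL) *L x⁻¹      ∎
  where
  open ≈-Reasoning
  F = invFact (suc (k ℕ.* 2))

Gen-x⁻¹ : ∀ n → Gen x⁻¹ n ≈ denominator n *L x⁻¹
Gen-x⁻¹ n with even⊎odd n
... | inj₁ (k , refl) = Gen-x⁻¹-even k
... | inj₂ (k , refl) = Gen-x⁻¹-odd k

x*constPS-1 : ∀ n → xL *L constPS 1L n ≈ constPS xL n
x*constPS-1 zero    = *-identityʳ xL
x*constPS-1 (suc n) = ≈-refl

denominator*Gen-x : ∀ n → cauchy denominator (Gen xL) n ≈ constPS xL n
denominator*Gen-x n = begin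
  cauchy denominator (Gen xL) n                 ≈⟨ *-identityˡ _ ⟨
  1L *L cauchy denominator (Gen xL) n           ≈⟨ *-congˡ _ x*x⁻¹≈1 ⟨
  (xL *L x⁻¹) *L cauchy denominator (Gen xL) n  ≈⟨ *-assoc xL x⁻¹ _ ⟩
  xL *L (x⁻¹ *L cauchy denominator (Gen xL) n)  ≈⟨ *-congʳ xL (cauchy-*ˡ n x⁻¹ denominator (Gen xL)) ⟨
  xL *L cauchy (λ k → x⁻¹ *L denominator k) (Gen xL) n
    ≈⟨ *-congʳ xL (cauchy-cong n (λ k → ≈-trans (*-comm x⁻¹ (denominator k)) (≈-sym (Gen-x⁻¹ k)))
                                 (λ _ → ≈-refl)) ⟩
  xL *L cauchy (Gen x⁻¹) (Gen xL) n             ≈⟨ *-congʳ xL (Gen-*L x⁻¹ xL n) ⟨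
  xL *L Gen (x⁻¹ *L xL) n                       ≈⟨ *-congʳ xL (Gen-cong (≈-trans (*-comm x⁻¹ xL) x*x⁻¹≈1) n) ⟩
  xL *L Gen 1L n                                ≈⟨ *-congʳ xL (Gen-1 n) ⟩
  xL *L constPS 1L n                            ≈⟨ x*constPS-1 n ⟩
  constPS xL n                                  ∎
  where open ≈-Reasoning

corr≈cauchy : ∀ N B m j → corr B (quotList N B m) j ≈ cauchy (λ i → B (suc (i ℕ.+ j))) (N ÷PS B) m
corr≈cauchy N B zero    j = +-identityʳ (B (suc j) *L N 0)
corr≈cauchy N B (suc m) j = +-cong (≈-refl {B (suc j) *L (N ÷PS B) (suc m)})
  (≈-trans (corr≈cauchy N B m (suc j))
           (cauchy-cong m (λ i → ≡⇒≈ (cong (B ∘ suc) (ℕP.+-suc i j))) (λ _ → ≈-refl)))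

÷PS-unique : ∀ N B G → B 0 ≈ 1L → (∀ n → cauchy B G n ≈ N n) → ∀ n → (N ÷PS B) n ≈ G n
÷PS-unique N B G B₀≈1 BG≈N n = bounded n n ℕP.≤-refl
  where
  open ≈-Reasoning
  open Algebra.Properties.AbelianGroup (CommutativeRing.+-abelianGroup LRing) using (xyx⁻¹≈y)
  bounded : ∀ n k → k ℕ.≤ n → (N ÷PS B) k ≈ G k
  bounded zero    .zero ℕ.z≤n = begin
    N 0                ≈⟨ BG≈N 0 ⟨
    B 0 *L G 0         ≈⟨ *-congˡ (G 0) B₀≈1 ⟩
    1L *L G 0          ≈⟨ *-identityˡ (G 0) ⟩
    G 0                ∎
  bounded (suc n) k k≤1+n with ℕP.m≤n⇒m<n∨m≡n k≤1+n
  ... | inj₁ (ℕ.s≤s k≤n) = bounded n k k≤n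
  ... | inj₂ refl = begin
    N (suc n) -L corr B (quotList N B n) 0
      ≈⟨ +-cong (≈-refl {N (suc n)}) (neg-cong (corr≈cauchy N B n 0)) ⟩
    N (suc n) -L cauchy (λ i → B (suc (i ℕ.+ 0))) (N ÷PS B) n
      ≈⟨ +-cong (≈-sym (BG≈N (suc n)))
                (neg-cong (≈-trans (cauchy-cong n (λ i → ≡⇒≈ (cong (B ∘ suc) (ℕP.+-identityʳ i)))
                                                  (λ _ → ≈-refl))
                                   (cauchy-congʳ-≤ n (B ∘ suc) (bounded n)))) ⟩
    (B 0 *L G (suc n) +L C) -L C
      ≈⟨ +-cong (+-comm (B 0 *L G (suc n)) C) (≈-refl { -L C}) ⟩
    (C +L B 0 *L G (suc n)) -L C
      ≈⟨ xyx⁻¹≈y C (B 0 *L G (suc n)) ⟩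
    B 0 *L G (suc n)
      ≈⟨ *-congˡ (G (suc n)) B₀≈1 ⟩
    1L *L G (suc n)
      ≈⟨ *-identityˡ (G (suc n)) ⟩
    G (suc n) ∎
    where C = cauchy (B ∘ suc) G n

corollary2p4 : Gen xL ≈PS (constPS xL ÷PS (coshS -PS (sinhS/s *PS yL)))
corollary2p4 n = coeffs-≡ (≈-sym (÷PS-unique (constPS xL) denominator (Gen xL) ≈-refl denominator*Gen-x n))
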